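{- Let $\Delta\geq 4$ be an integer. If $G$ is a $\rho$-$\Delta$-critical graph, then $G$ contains no triangle $uvw$ with $\deg_G(u)=2$, $\deg_G(v)=3$ and $\deg_G(w)=4$.
   Context: All graphs are simple. For a graph $G$, an incidence is a pair $(v,e)$ with $v$ an endpoint of the edge $e$; $I(G)$ is the set of incidences. For $u\in V(G)$ and a neighbor $v$, $(u,uv)$ is a strong incidence of $u$ and $(v,uv)$ is a weak incidence of $u$; $I_u$, $A_u$ denote the sets of strong, resp. weak, incidences of $u$. Let $[\Delta]=\{1,\dots,\Delta\}$. A conditional incidence $\Delta$-coloring of $G$ is a map $\varphi: I(G)\to[\Delta]$ such that: (a) $(u,uv)$ and $(v,uv)$ receive distinct colors for each edge $uv$; (b) each color appears at most once among $A_u$ for each vertex $u$; (c) each color appears at most once among $I_u$ for each vertex $u$; (d) each color of $[\Delta]$ appears at least once among $A_u\cup I_u$ for each vertex $u$ with $\deg_G(u)\geq\Delta-1$. A graph $G$ is $\rho$-$\Delta$-critical if $\Delta(G)\leq\Delta$, $G$ has no conditional incidence $\Delta$-coloring, but every proper subgraph of $G$ has one. -}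

module Defs where

open import Data.Nat using (ℕ; zero; suc; _≤_; _<_; _∸_)
open import Data.Fin using (Fin)
open import Data.Bool using (Bool; true; false; if_then_else_)
open import Data.List using (List; map; allFin)
open import Data.Nat.ListAction using (sum)
open import Data.Product using (Σ; ∃; ∃-syntax; _×_; _,_)
open import Data.Sum using (_⊎_)
open import Relation.Nullary using (¬_)
open import Relation.Binary.PropositionalEquality using (_≡_; _≢_)
open import Function.Definitions using (Injective)

record Graph : Set where
  field
    n     : ℕ
    adj   : Fin n → Fin n → Bool
    sym   : ∀ u v → adj u v ≡ adj v u
    irref : ∀ u → adj u u ≡ false
open Graph public

Adj : (G : Graph) → Fin (n G) → Fin (n G) → Set
Adj G u v = adj G u v ≡ true

deg : (G : Graph) → Fin (n G) → ℕ
deg G u = sum (map (λ v → if adj G u v then 1 else 0) (allFin (n G)))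

MaxDeg≤ : Graph → ℕ → Set
MaxDeg≤ G Δ = ∀ u → deg G u ≤ Δ

-- Incidence (u, uv) is represented by the ordered pair (u , v) with Adj G u v.
-- A colouring assigns a colour in [Δ] = Fin Δ to each incidence; φ u v is the
-- colour of (u, uv) (values on non-adjacent pairs are irrelevant).
-- Strong incidences of u: (u,uv), coloured φ u v.  Weak: (v,uv), coloured φ v u.
record IsCondIncColoring (G : Graph) (Δ : ℕ) (φ : Fin (n G) → Fin (n G) → Fin Δ) : Set where
  field
    condA : ∀ u v → Adj G u v → φ u v ≢ φ v u
    condB : ∀ u v w → Adj G u v → Adj G u w → φ v u ≡ φ w u → v ≡ w
    condC : ∀ u v w → Adj G u v → Adj G u w → φ u v ≡ φ u w → v ≡ w
    condD : ∀ u → Δ ∸ 1 ≤ deg G u → ∀ (c : Fin Δ) →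
            ∃[ v ] (Adj G u v × (φ u v ≡ c ⊎ φ v u ≡ c))

HasCondIncColoring : Graph → ℕ → Set
HasCondIncColoring G Δ = ∃[ φ ] IsCondIncColoring G Δ φ

record SubgraphEmb (H G : Graph) : Set where
  field
    f       : Fin (n H) → Fin (n G)
    f-inj   : Injective _≡_ _≡_ f
    f-edge  : ∀ i j → Adj H i j → Adj G (f i) (f j)

ProperEmb : (H G : Graph) → SubgraphEmb H G → Set
ProperEmb H G e =
  (∃[ x ] (∀ i → SubgraphEmb.f e i ≢ x)) ⊎
  (∃[ x ] ∃[ y ] (Adj G x y ×
     (∀ i j → SubgraphEmb.f e i ≡ x → SubgraphEmb.f e j ≡ y → ¬ Adj H i j)))

record Critical (Δ : ℕ) (G : Graph) : Set₁ where
  field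
    maxDeg     : MaxDeg≤ G Δ
    noColoring : ¬ HasCondIncColoring G Δ
    minimal    : ∀ (H : Graph) (e : SubgraphEmb H G) → ProperEmb H G e →
                 HasCondIncColoring H Δ

{-# OPTIONS --safe #-}
-- Delete the edges from u to a set D of its neighbours, D = {v} if Δ ≥ 5 and D = {v, w} if
-- Δ = 4.  By minimality the smaller graph H has a colouring φ, and it extends to G once the
-- incidences of the deleted edges get colours avoiding the ones already present around u and
-- the vertices of D and, at the vertices of D of degree ≥ Δ - 1, completing the colour set
-- (condition (d) is void at u, as deg u = 2 < Δ - 1).  For Δ ≥ 5 only four colours have to be
-- avoided at v and deg v < Δ - 1.  For Δ = 4, w has degree 3 = Δ - 1 in H, so all four colours
-- already appear at w in H; hence the free colours γ for (u, uw) and δ for (w, uw) differ, and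
-- a case analysis in the four colours finds colours for (u, uv) and (v, uv) that complete the
-- colour sets at v and w.
module Submission where

open import Data.Nat using (ℕ; zero; suc; _+_; _∸_; _≤_; _<_; z≤n; s≤s)
open import Data.Nat.Properties
  using (≤-refl; ≤-reflexive; ≤-trans; n≤1+n; m≤n⇒m<n∨m≡n; <⇒≱; <-irrefl; +-suc; +-monoʳ-≤; ∸-monoˡ-≤)
open import Data.Nat.ListAction using (sum)
open import Data.Fin using (Fin; zero; suc; _≟_)
open import Data.Fin.Properties using (any?; ¬∀⟶∃¬)
open import Data.Bool using (Bool; true; false; if_then_else_; _∧_; _∨_; not)
open import Data.Bool.Properties using (∧-zeroʳ; ∧-identityʳ; ∨-comm)
import Data.Bool.Properties as Bool
open import Data.List using (List; []; _∷_; length; map; tabulate; allFin)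
open import Data.List.Properties using (map-cong)
open import Data.List.Membership.Propositional using (_∈_; _∉_)
open import Data.List.Relation.Unary.Any using (here; there)
open import Data.List.Relation.Unary.Any.Properties using (¬Any[])
import Data.List.Relation.Unary.Any as Any
open import Data.List.Relation.Unary.All using (All; []; _∷_; lookup)
open import Data.List.Relation.Unary.All.Properties.Core using (¬Any⇒All¬)
open import Data.List.Relation.Unary.AllPairs using ([]; _∷_)
open import Data.List.Relation.Unary.Unique.Propositional using (Unique)
open import Data.Vec.Functional using (updateAt)
open import Data.Vec.Functional.Properties using (updateAt-updates; updateAt-minimal)
open import Data.Product using (∃; ∃-syntax; _×_; _,_)
open import Data.Sum using (_⊎_; inj₁; inj₂)
open import Data.Empty using (⊥; ⊥-elim)
open import Function using (_∘_; id; const)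
open import Relation.Nullary using (¬_; Dec; yes; no; ¬?; does)
open import Relation.Nullary.Decidable using (_×-dec_; dec-true; dec-false; toSum)
open import Relation.Binary.PropositionalEquality
  using (_≡_; _≢_; refl; sym; trans; cong; cong₂; subst; ≢-sym)
open import Defs hiding (sym)

_∈?_ : ∀ {m} (x : Fin m) (xs : List (Fin m)) → Dec (x ∈ xs)
x ∈? xs = Any.any? (x ≟_) xs

pattern 1st = here refl
pattern 2nd = there 1st
pattern 3rd = there 2nd
pattern 4th = there 3rd
pattern 5th = there 4th
pattern 6th = there 5th

∉-singleton : ∀ {A : Set} {a b : A} → a ≢ b → a ∉ b ∷ []
∉-singleton a≢b (here a≡b) = a≢b a≡b

∉-pair : ∀ {A : Set} {a b c : A} → a ≢ b → a ≢ c → a ∉ b ∷ c ∷ []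
∉-pair a≢b a≢c (here a≡b)         = a≢b a≡b
∉-pair a≢b a≢c (there (here a≡c)) = a≢c a≡c

-- Counting in Fin m

count : ∀ {m} → (Fin m → Bool) → ℕ
count {zero}  p = 0
count {suc m} p = (if p zero then 1 else 0) + count (p ∘ suc)

erase : ∀ {m} → (Fin m → Bool) → Fin m → Fin m → Bool
erase p a = updateAt p a (const false)

erase-true : ∀ {m} (p : Fin m → Bool) a {i} → erase p a i ≡ true → i ≢ a × p i ≡ true
erase-true p a {i} e with i ≟ a
... | yes refl with () ← trans (sym (updateAt-updates a p)) e
... | no i≢a = i≢a , trans (sym (updateAt-minimal i a p i≢a)) e

count-erase : ∀ {m} (p : Fin m → Bool) a → p a ≡ true → count p ≡ suc (count (erase p a))
count-erase {suc m} p zero    pa rewrite pa = refl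
count-erase {suc m} p (suc a) pa =
  trans (cong ((if p zero then 1 else 0) +_) (count-erase (p ∘ suc) a pa)) (+-suc _ _)

count-≤-erase : ∀ {m} (p : Fin m → Bool) a → count p ≤ suc (count (erase p a))
count-≤-erase {suc m} p zero with p zero
... | true  = ≤-refl
... | false = n≤1+n _
count-≤-erase {suc m} p (suc a) =
  ≤-trans (+-monoʳ-≤ (if p zero then 1 else 0) (count-≤-erase (p ∘ suc) a))
          (≤-reflexive (+-suc _ _))

count-none : ∀ {m} (p : Fin m → Bool) → (∀ i → p i ≢ true) → count p ≡ 0
count-none {zero}  p none = refl
count-none {suc m} p none with p zero in p0
... | true  = ⊥-elim (none zero p0)
... | false = count-none (p ∘ suc) (none ∘ suc)

count-≤-length : ∀ {m} (p : Fin m → Bool) (xs : List (Fin m)) →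
                 (∀ i → p i ≡ true → i ∈ xs) → count p ≤ length xs
count-≤-length p []       sub = ≤-reflexive (count-none p (λ i → ¬Any[] ∘ sub i))
count-≤-length p (a ∷ xs) sub = ≤-trans (count-≤-erase p a) (s≤s (count-≤-length (erase p a) xs sub′))
  where
  sub′ : ∀ i → erase p a i ≡ true → i ∈ xs
  sub′ i e with erase-true p a e
  ... | i≢a , pi with sub i pi
  ...   | here i≡a = ⊥-elim (i≢a i≡a)
  ...   | there i∈xs = i∈xs

length-≤-count : ∀ {m} (p : Fin m → Bool) {xs : List (Fin m)} → Unique xs →
                 (∀ i → i ∈ xs → p i ≡ true) → length xs ≤ count p
length-≤-count p {[]}     _              _   = z≤n
length-≤-count p {a ∷ xs} (a∉xs ∷ uniq) sup =
  subst (suc (length xs) ≤_) (sym (count-erase p a (sup a (here refl))))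
    (s≤s (length-≤-count (erase p a) uniq sup′))
  where
  sup′ : ∀ i → i ∈ xs → erase p a i ≡ true
  sup′ i i∈xs = trans (updateAt-minimal i a p (≢-sym (lookup a∉xs i∈xs))) (sup i (there i∈xs))

count-true : ∀ {m} → count {m} (const true) ≡ m
count-true {zero}  = refl
count-true {suc m} = cong suc (count-true {m})

∉-exists : ∀ {m} (xs : List (Fin m)) → length xs < m → ∃ λ c → c ∉ xs
∉-exists {m} xs len<m = ¬∀⟶∃¬ m (_∈ xs) (_∈? xs) λ ∈-all →
  <⇒≱ len<m (subst (_≤ length xs) count-true (count-≤-length (const true) xs (λ c _ → ∈-all c)))

unique-covers : ∀ {m} {xs : List (Fin m)} → Unique xs → length xs ≡ m → ∀ c → c ∈ xs
unique-covers {m} {xs} uniq len c with c ∈? xs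
... | yes c∈xs = c∈xs
... | no  c∉xs = ⊥-elim (<-irrefl len (subst (suc (length xs) ≤_) count-true
                   (length-≤-count (const true) (¬Any⇒All¬ xs c∉xs ∷ uniq) (λ _ _ → refl))))

-- Degrees and neighbourhoods

Adj-sym : (G : Graph) {a b : Fin (n G)} → Adj G a b → Adj G b a
Adj-sym G {a} {b} ab = trans (Graph.sym G b a) ab

Adj⇒≢ : (G : Graph) {a b : Fin (n G)} → Adj G a b → a ≢ b
Adj⇒≢ G {a} aa refl with () ← trans (sym (irref G a)) aa

sum-indicator-tabulate : ∀ {m k} (p : Fin k → Bool) (g : Fin m → Fin k) →
                         sum (map (λ v → if p v then 1 else 0) (tabulate g)) ≡ count (p ∘ g)
sum-indicator-tabulate {zero}  p g = refl
sum-indicator-tabulate {suc m} p g = cong (_ +_) (sum-indicator-tabulate p (g ∘ suc))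

deg≡count : (G : Graph) (a : Fin (n G)) → deg G a ≡ count (adj G a)
deg≡count G a = sum-indicator-tabulate (adj G a) id

∃-neighbour-∉ : (G : Graph) (a : Fin (n G)) (xs : List (Fin (n G))) → length xs < deg G a →
                ∃ λ q → Adj G a q × q ∉ xs
∃-neighbour-∉ G a xs len<deg with any? (λ q → (adj G a q Bool.≟ true) ×-dec ¬? (q ∈? xs))
... | yes found = found
... | no ¬found = ⊥-elim (<⇒≱ len<deg (subst (_≤ length xs) (sym (deg≡count G a))
                    (count-≤-length (adj G a) xs ∈-xs)))
  where
  ∈-xs : ∀ q → Adj G a q → q ∈ xs
  ∈-xs q aq with q ∈? xs
  ... | yes q∈xs = q∈xs
  ... | no  q∉xs = ⊥-elim (¬found (q , aq , q∉xs))

length-≤-deg : (G : Graph) (a : Fin (n G)) {xs : List (Fin (n G))} → Unique xs →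
               (∀ q → q ∈ xs → Adj G a q) → length xs ≤ deg G a
length-≤-deg G a uniq adjs = subst (_ ≤_) (sym (deg≡count G a)) (length-≤-count (adj G a) uniq adjs)

neighbours-⊆ : (G : Graph) (a : Fin (n G)) {xs : List (Fin (n G))} → Unique xs →
               (∀ q → q ∈ xs → Adj G a q) → deg G a ≡ length xs → ∀ q → Adj G a q → q ∈ xs
neighbours-⊆ G a {xs} uniq adjs deg≡len q aq with q ∈? xs
... | yes q∈xs = q∈xs
... | no  q∉xs = ⊥-elim (<-irrefl refl (subst (suc (length xs) ≤_) deg≡len
                    (length-≤-deg G a (¬Any⇒All¬ xs q∉xs ∷ uniq) adjs′)))
  where
  adjs′ : ∀ r → r ∈ q ∷ xs → Adj G a r
  adjs′ r (here refl)  = aq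
  adjs′ r (there r∈xs) = adjs r r∈xs

Appears : (G : Graph) {Δ : ℕ} → (Fin (n G) → Fin (n G) → Fin Δ) → Fin (n G) → Fin Δ → Set
Appears G ψ a c = ∃[ r ] (Adj G a r × (ψ a r ≡ c ⊎ ψ r a ≡ c))

-- Deleting the edges between a vertex and some of its neighbours

module Severed (G : Graph) (u : Fin (n G)) (ds : List (Fin (n G))) where

  private
    V : Set
    V = Fin (n G)

  severed : V → V → Bool
  severed a b = does (a ≟ u) ∧ does (b ∈? ds) ∨ does (b ≟ u) ∧ does (a ∈? ds)

  H : Graph
  H = record
    { n     = n G
    ; adj   = λ a b → adj G a b ∧ not (severed a b)
    ; sym   = λ a b → cong₂ _∧_ (Graph.sym G a b) (cong not (∨-comm (does (a ≟ u) ∧ does (b ∈? ds)) _))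
    ; irref = λ a → cong (_∧ not (severed a a)) (irref G a)
    }

  adj-H : ∀ {a b} → severed a b ≡ false → adj H a b ≡ adj G a b
  adj-H {a} {b} s rewrite s = ∧-identityʳ (adj G a b)

  severed-away : ∀ {a b} → a ≢ u → b ≢ u → severed a b ≡ false
  severed-away {a} {b} a≢u b≢u rewrite dec-false (a ≟ u) a≢u | dec-false (b ≟ u) b≢u = refl

  severed-kept : ∀ {a b} → a ≢ u → a ∉ ds → severed a b ≡ false
  severed-kept {a} {b} a≢u a∉ds rewrite dec-false (a ≟ u) a≢u | dec-false (a ∈? ds) a∉ds =
    ∧-zeroʳ (does (b ≟ u))

  Adj-H⇒G : ∀ {a b} → Adj H a b → Adj G a b
  Adj-H⇒G {a} {b} h with adj G a b
  ... | true = refl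

  Adj-away : ∀ {a b} → a ≢ u → b ≢ u → Adj G a b → Adj H a b
  Adj-away a≢u b≢u ab = trans (adj-H (severed-away a≢u b≢u)) ab

  Adj-kept : ∀ {a b} → a ≢ u → a ∉ ds → Adj G a b → Adj H a b
  Adj-kept a≢u a∉ds ab = trans (adj-H (severed-kept a≢u a∉ds)) ab

  ¬Adj-severed : ∀ {b} → b ∈ ds → ¬ Adj H u b
  ¬Adj-severed {b} b∈ds h
    rewrite dec-true (u ≟ u) refl | dec-true (b ∈? ds) b∈ds | ∧-zeroʳ (adj G u b)
    with () ← h

  deg-kept : ∀ {a} → a ≢ u → a ∉ ds → deg H a ≡ deg G a
  deg-kept a≢u a∉ds =
    cong sum (map-cong (λ b → cong (λ x → if x then 1 else 0) (adj-H (severed-kept a≢u a∉ds))) (allFin (n G)))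

  inclusion : SubgraphEmb H G
  inclusion = record { f = λ i → i ; f-inj = λ e → e ; f-edge = λ _ _ → Adj-H⇒G }

  inclusion-proper : ∀ {b} → b ∈ ds → Adj G u b → ProperEmb H G inclusion
  inclusion-proper {b} b∈ds ub = inj₂ (u , b , ub , λ { _ _ refl refl → ¬Adj-severed b∈ds })

  module Extension {Δ : ℕ} (φ : V → V → Fin Δ) (A B : V → Fin Δ) where

    ψ : V → V → Fin Δ
    ψ a b with a ≟ u
    ... | yes _ = A b
    ... | no _ with b ≟ u
    ...   | yes _ = B a
    ...   | no _  = φ a b

    ψ-from-u : ∀ b → ψ u b ≡ A b
    ψ-from-u b with u ≟ u
    ... | yes _   = refl
    ... | no u≢u = ⊥-elim (u≢u refl)

    ψ-to-u : ∀ {a} → a ≢ u → ψ a u ≡ B a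
    ψ-to-u {a} a≢u with a ≟ u
    ... | yes a≡u = ⊥-elim (a≢u a≡u)
    ... | no _ with u ≟ u
    ...   | yes _   = refl
    ...   | no u≢u = ⊥-elim (u≢u refl)

    ψ-away : ∀ {a b} → a ≢ u → b ≢ u → ψ a b ≡ φ a b
    ψ-away {a} {b} a≢u b≢u with a ≟ u
    ... | yes a≡u = ⊥-elim (a≢u a≡u)
    ... | no _ with b ≟ u
    ...   | yes b≡u = ⊥-elim (b≢u b≡u)
    ...   | no _    = refl

    module _ (φ-col : IsCondIncColoring H Δ φ)
             (A-kept : ∀ b → b ∉ ds → A b ≡ φ u b)
             (B-kept : ∀ b → b ∉ ds → B b ≡ φ b u)
             (A≢B : ∀ b → b ∈ ds → A b ≢ B b)
             (A-distinct : ∀ b c → b ∈ ds → Adj G u c → b ≢ c → A b ≢ A c)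
             (B-distinct : ∀ b c → b ∈ ds → Adj G u c → b ≢ c → B b ≢ B c)
             (A-fresh : ∀ a c → a ∈ ds → Adj G a c → c ≢ u → φ c a ≢ A a)
             (B-fresh : ∀ a c → a ∈ ds → Adj G a c → c ≢ u → φ a c ≢ B a)
             (covers-u : Δ ∸ 1 ≤ deg G u → ∀ c → Appears G ψ u c)
             (covers-ds : ∀ a → a ∈ ds → Δ ∸ 1 ≤ deg G a → ∀ c → Appears G ψ a c)
             where
      open IsCondIncColoring φ-col

      private
        -- Splitting with `a ≟ u` would also abstract the `a ≟ u` hidden inside ψ a b.
        ≡u? : ∀ a → a ≡ u ⊎ a ≢ u
        ≡u? a = toSum (a ≟ u)

        Adj-from-u : ∀ {b} → Adj G u b → b ∉ ds → Adj H u b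
        Adj-from-u ub b∉ds = Adj-sym H (Adj-kept (Adj⇒≢ G (Adj-sym G ub)) b∉ds (Adj-sym G ub))

      A≢B-at : ∀ b → Adj G u b → A b ≢ B b
      A≢B-at b ub e with b ∈? ds
      ... | yes b∈ds = A≢B b b∈ds e
      ... | no  b∉ds = condA u b (Adj-from-u ub b∉ds) (trans (sym (A-kept b b∉ds)) (trans e (B-kept b b∉ds)))

      injective-at-u : (F g : V → Fin Δ) →
                       (∀ b c → b ∈ ds → Adj G u c → b ≢ c → F b ≢ F c) →
                       (∀ b → b ∉ ds → F b ≡ g b) →
                       (∀ b c → Adj H u b → Adj H u c → g b ≡ g c → b ≡ c) →
                       ∀ b c → Adj G u b → Adj G u c → F b ≡ F c → b ≡ c
      injective-at-u F g F-distinct F-kept g-inj b c ub uc e with b ≟ c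
      ... | yes b≡c = b≡c
      ... | no b≢c with b ∈? ds | c ∈? ds
      ...   | yes b∈ds | _        = ⊥-elim (F-distinct b c b∈ds uc b≢c e)
      ...   | no _     | yes c∈ds = ⊥-elim (F-distinct c b c∈ds ub (≢-sym b≢c) (sym e))
      ...   | no b∉ds  | no c∉ds  =
        g-inj b c (Adj-from-u ub b∉ds) (Adj-from-u uc c∉ds)
          (trans (sym (F-kept b b∉ds)) (trans e (F-kept c c∉ds)))

      A≢weak : ∀ a c → a ≢ u → Adj G a u → Adj G a c → c ≢ u → A a ≢ φ c a
      A≢weak a c a≢u au ac c≢u e with a ∈? ds
      ... | yes a∈ds = A-fresh a c a∈ds ac c≢u (sym e)
      ... | no  a∉ds = c≢u (sym (condB a u c (Adj-kept a≢u a∉ds au) (Adj-kept a≢u a∉ds ac)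
                                   (trans (sym (A-kept a a∉ds)) e)))

      B≢strong : ∀ a c → a ≢ u → Adj G a u → Adj G a c → c ≢ u → B a ≢ φ a c
      B≢strong a c a≢u au ac c≢u e with a ∈? ds
      ... | yes a∈ds = B-fresh a c a∈ds ac c≢u (sym e)
      ... | no  a∉ds = c≢u (sym (condC a u c (Adj-kept a≢u a∉ds au) (Adj-kept a≢u a∉ds ac)
                                   (trans (sym (B-kept a a∉ds)) e)))

      ψ-condA : ∀ a b → Adj G a b → ψ a b ≢ ψ b a
      ψ-condA a b ab e with ≡u? a | ≡u? b
      ... | inj₁ refl | _         =
        A≢B-at b ab (trans (sym (ψ-from-u b)) (trans e (ψ-to-u (Adj⇒≢ G (Adj-sym G ab)))))
      ... | inj₂ a≢u  | inj₁ refl =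
        A≢B-at a (Adj-sym G ab) (trans (sym (ψ-from-u a)) (trans (sym e) (ψ-to-u a≢u)))
      ... | inj₂ a≢u  | inj₂ b≢u  =
        condA a b (Adj-away a≢u b≢u ab) (trans (sym (ψ-away a≢u b≢u)) (trans e (ψ-away b≢u a≢u)))

      ψ-condB : ∀ a b c → Adj G a b → Adj G a c → ψ b a ≡ ψ c a → b ≡ c
      ψ-condB a b c ab ac e with ≡u? a
      ... | inj₁ refl =
        injective-at-u B (λ b → φ b u) B-distinct B-kept (λ b c → condB u b c) b c ab ac
          (trans (sym (ψ-to-u (Adj⇒≢ G (Adj-sym G ab)))) (trans e (ψ-to-u (Adj⇒≢ G (Adj-sym G ac)))))
      ... | inj₂ a≢u with ≡u? b | ≡u? c
      ...   | inj₁ refl | inj₁ refl = refl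
      ...   | inj₁ refl | inj₂ c≢u  =
        ⊥-elim (A≢weak a c a≢u ab ac c≢u (trans (sym (ψ-from-u a)) (trans e (ψ-away c≢u a≢u))))
      ...   | inj₂ b≢u  | inj₁ refl =
        ⊥-elim (A≢weak a b a≢u ac ab b≢u (trans (sym (ψ-from-u a)) (trans (sym e) (ψ-away b≢u a≢u))))
      ...   | inj₂ b≢u  | inj₂ c≢u  =
        condB a b c (Adj-away a≢u b≢u ab) (Adj-away a≢u c≢u ac)
          (trans (sym (ψ-away b≢u a≢u)) (trans e (ψ-away c≢u a≢u)))

      ψ-condC : ∀ a b c → Adj G a b → Adj G a c → ψ a b ≡ ψ a c → b ≡ c
      ψ-condC a b c ab ac e with ≡u? a
      ... | inj₁ refl =
        injective-at-u A (φ u) A-distinct A-kept (λ b c → condC u b c) b c ab ac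
          (trans (sym (ψ-from-u b)) (trans e (ψ-from-u c)))
      ... | inj₂ a≢u with ≡u? b | ≡u? c
      ...   | inj₁ refl | inj₁ refl = refl
      ...   | inj₁ refl | inj₂ c≢u  =
        ⊥-elim (B≢strong a c a≢u ab ac c≢u (trans (sym (ψ-to-u a≢u)) (trans e (ψ-away a≢u c≢u))))
      ...   | inj₂ b≢u  | inj₁ refl =
        ⊥-elim (B≢strong a b a≢u ac ab b≢u (trans (sym (ψ-to-u a≢u)) (trans (sym e) (ψ-away a≢u b≢u))))
      ...   | inj₂ b≢u  | inj₂ c≢u  =
        condC a b c (Adj-away a≢u b≢u ab) (Adj-away a≢u c≢u ac)
          (trans (sym (ψ-away a≢u b≢u)) (trans e (ψ-away a≢u c≢u)))

      ψ-condD : ∀ a → Δ ∸ 1 ≤ deg G a → ∀ c → Appears G ψ a c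
      ψ-condD a big c with ≡u? a
      ... | inj₁ refl = covers-u big c
      ... | inj₂ a≢u with a ∈? ds
      ...   | yes a∈ds = covers-ds a a∈ds big c
      ...   | no  a∉ds with condD a (subst (Δ ∸ 1 ≤_) (sym (deg-kept a≢u a∉ds)) big) c
      ...     | r , ar , seen = r , Adj-H⇒G ar , transport seen
        where
        transport : φ a r ≡ c ⊎ φ r a ≡ c → ψ a r ≡ c ⊎ ψ r a ≡ c
        transport seen with ≡u? r | seen
        ... | inj₁ refl | inj₁ s = inj₁ (trans (ψ-to-u a≢u) (trans (B-kept a a∉ds) s))
        ... | inj₁ refl | inj₂ s = inj₂ (trans (ψ-from-u a) (trans (A-kept a a∉ds) s))
        ... | inj₂ r≢u  | inj₁ s = inj₁ (trans (ψ-away a≢u r≢u) s)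
        ... | inj₂ r≢u  | inj₂ s = inj₂ (trans (ψ-away r≢u a≢u) s)

      extension : IsCondIncColoring G Δ ψ
      extension = record { condA = ψ-condA ; condB = ψ-condB ; condC = ψ-condC ; condD = ψ-condD }

-- Colour choices in [4]

four-covers : {a b c d : Fin 4} → a ≢ b → a ≢ c → a ≢ d → b ≢ c → b ≢ d → c ≢ d →
              ∀ x → x ∈ a ∷ b ∷ c ∷ d ∷ []
four-covers a≢b a≢c a≢d b≢c b≢d c≢d =
  unique-covers ((a≢b ∷ a≢c ∷ a≢d ∷ []) ∷ (b≢c ∷ b≢d ∷ []) ∷ (c≢d ∷ []) ∷ [] ∷ []) refl

fourth : (a b c : Fin 4) → ∃ λ d → d ≢ a × d ≢ b × d ≢ c
fourth a b c with d , d∉ ← ∉-exists (a ∷ b ∷ c ∷ []) (s≤s (s≤s (s≤s (s≤s z≤n)))) =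
  d , d∉ ∘ here , d∉ ∘ there ∘ here , d∉ ∘ there ∘ there ∘ here

∈-⊆ : ∀ {A : Set} {xs ys : List A} → All (_∈ ys) xs → ∀ {x} → x ∈ xs → x ∈ ys
∈-⊆ = lookup

-- For the triangle uvw and the third neighbour x of v: s₁, s₂ colour (v, vw), (v, vx) and
-- t₁, t₂ colour (w, vw), (x, vx); γ, δ are the new colours of (u, uw), (w, uw), and α, β
-- will colour (u, uv), (v, uv).
record PairChoice (s₁ s₂ t₁ t₂ γ δ : Fin 4) : Set where
  field
    α β    : Fin 4
    α≢β    : α ≢ β
    α≢γ    : α ≢ γ
    β≢δ    : β ≢ δ
    α∉t    : α ∉ t₁ ∷ t₂ ∷ []
    β∉s    : β ∉ s₁ ∷ s₂ ∷ []
    covers : ∀ c → c ∈ s₁ ∷ s₂ ∷ t₁ ∷ t₂ ∷ α ∷ β ∷ []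

pair-choice-swap : ∀ {s₁ s₂ t₁ t₂ γ δ} → PairChoice t₁ t₂ s₁ s₂ δ γ → PairChoice s₁ s₂ t₁ t₂ γ δ
pair-choice-swap p = record
  { α = β ; β = α ; α≢β = ≢-sym α≢β ; α≢γ = β≢δ ; β≢δ = α≢γ ; α∉t = β∉s ; β∉s = α∉t
  ; covers = λ c → ∈-⊆ (3rd ∷ 4th ∷ 1st ∷ 2nd ∷ 6th ∷ 5th ∷ []) (covers c)
  }
  where open PairChoice p

pair-choice-disjoint : ∀ {s₁ s₂ t₁ t₂ γ δ} → s₁ ≢ s₂ → t₁ ≢ t₂ → s₁ ≢ t₁ → s₁ ≢ t₂ → s₂ ≢ t₁ → s₂ ≢ t₂ →
                       γ ≢ s₁ → δ ≢ t₁ → PairChoice s₁ s₂ t₁ t₂ γ δ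
pair-choice-disjoint {s₁} {t₁ = t₁} s₁≢s₂ t₁≢t₂ s₁≢t₁ s₁≢t₂ s₂≢t₁ s₂≢t₂ γ≢s₁ δ≢t₁ = record
  { α = s₁ ; β = t₁ ; α≢β = s₁≢t₁ ; α≢γ = ≢-sym γ≢s₁ ; β≢δ = ≢-sym δ≢t₁
  ; α∉t = ∉-pair s₁≢t₁ s₁≢t₂ ; β∉s = ∉-pair (≢-sym s₁≢t₁) (≢-sym s₂≢t₁)
  ; covers = λ c → ∈-⊆ (1st ∷ 2nd ∷ 3rd ∷ 4th ∷ [])
                       (four-covers s₁≢s₂ s₁≢t₁ s₁≢t₂ s₂≢t₁ s₂≢t₂ t₁≢t₂ c)
  }

pair-choice-one-shared : ∀ {s₁ s₂ t₁ γ δ} → s₁ ≢ s₂ → s₁ ≢ t₁ → s₂ ≢ t₁ → δ ≢ t₁ → γ ≢ δ →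
                         PairChoice s₁ s₂ t₁ s₁ γ δ
pair-choice-one-shared {s₁} {s₂} {t₁} {γ} s₁≢s₂ s₁≢t₁ s₂≢t₁ δ≢t₁ γ≢δ
  with m , m≢s₁ , m≢s₂ , m≢t₁ ← fourth s₁ s₂ t₁
  with γ ≟ m | four-covers s₁≢s₂ s₁≢t₁ (≢-sym m≢s₁) s₂≢t₁ (≢-sym m≢s₂) (≢-sym m≢t₁)
... | no γ≢m | covers₄ = record
  { α = m ; β = t₁ ; α≢β = m≢t₁ ; α≢γ = ≢-sym γ≢m ; β≢δ = ≢-sym δ≢t₁
  ; α∉t = ∉-pair m≢t₁ m≢s₁ ; β∉s = ∉-pair (≢-sym s₁≢t₁) (≢-sym s₂≢t₁)
  ; covers = λ c → ∈-⊆ (1st ∷ 2nd ∷ 3rd ∷ 5th ∷ []) (covers₄ c)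
  }
... | yes refl | covers₄ = record
  { α = s₂ ; β = γ ; α≢β = ≢-sym m≢s₂ ; α≢γ = ≢-sym m≢s₂ ; β≢δ = γ≢δ
  ; α∉t = ∉-pair s₂≢t₁ (≢-sym s₁≢s₂) ; β∉s = ∉-pair m≢s₁ m≢s₂
  ; covers = λ c → ∈-⊆ (1st ∷ 2nd ∷ 3rd ∷ 6th ∷ []) (covers₄ c)
  }

pair-choice-both-shared : ∀ {s₁ s₂ γ δ} → s₁ ≢ s₂ → γ ≢ δ → PairChoice s₁ s₂ s₂ s₁ γ δ
pair-choice-both-shared {s₁} {s₂} {γ} {δ} s₁≢s₂ γ≢δ
  with m₁ , m₁≢s₁ , m₁≢s₂ , m₁≢γ ← fourth s₁ s₂ γ
  with m₂ , m₂≢s₁ , m₂≢s₂ , m₂≢m₁ ← fourth s₁ s₂ m₁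
  with m₂ ≟ δ
     | four-covers s₁≢s₂ (≢-sym m₁≢s₁) (≢-sym m₂≢s₁) (≢-sym m₁≢s₂) (≢-sym m₂≢s₂) (≢-sym m₂≢m₁)
... | no m₂≢δ | covers₄ = record
  { α = m₁ ; β = m₂ ; α≢β = ≢-sym m₂≢m₁ ; α≢γ = m₁≢γ ; β≢δ = m₂≢δ
  ; α∉t = ∉-pair m₁≢s₂ m₁≢s₁ ; β∉s = ∉-pair m₂≢s₁ m₂≢s₂
  ; covers = λ c → ∈-⊆ (1st ∷ 2nd ∷ 5th ∷ 6th ∷ []) (covers₄ c)
  }
... | yes refl | covers₄ = record
  { α = m₂ ; β = m₁ ; α≢β = m₂≢m₁ ; α≢γ = ≢-sym γ≢δ ; β≢δ = ≢-sym m₂≢m₁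
  ; α∉t = ∉-pair m₂≢s₂ m₂≢s₁ ; β∉s = ∉-pair m₁≢s₁ m₁≢s₂
  ; covers = λ c → ∈-⊆ (1st ∷ 2nd ∷ 6th ∷ 5th ∷ []) (covers₄ c)
  }

pair-choice : ∀ {s₁ s₂ t₁ t₂ γ δ} → s₁ ≢ s₂ → t₁ ≢ t₂ → s₁ ≢ t₁ → s₂ ≢ t₂ → γ ≢ s₁ → δ ≢ t₁ → γ ≢ δ →
              PairChoice s₁ s₂ t₁ t₂ γ δ
pair-choice {s₁} {s₂} {t₁} {t₂} s₁≢s₂ t₁≢t₂ s₁≢t₁ s₂≢t₂ γ≢s₁ δ≢t₁ γ≢δ with s₁ ≟ t₂ | s₂ ≟ t₁
... | no s₁≢t₂ | no s₂≢t₁ = pair-choice-disjoint s₁≢s₂ t₁≢t₂ s₁≢t₁ s₁≢t₂ s₂≢t₁ s₂≢t₂ γ≢s₁ δ≢t₁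
... | yes refl | no s₂≢t₁ = pair-choice-one-shared s₁≢s₂ s₁≢t₁ s₂≢t₁ δ≢t₁ γ≢δ
... | no s₁≢t₂ | yes refl =
  pair-choice-swap (pair-choice-one-shared t₁≢t₂ (≢-sym s₁≢t₁) (≢-sym s₁≢t₂) γ≢s₁ (≢-sym γ≢δ))
... | yes refl | yes refl = pair-choice-both-shared s₁≢s₂ γ≢δ

-- Reducing the triangle

module Triangle (G : Graph) {u v w x : Fin (n G)}
                (uv : Adj G u v) (vw : Adj G v w) (uw : Adj G u w) (vx : Adj G v x) (x∉ : x ∉ u ∷ w ∷ [])
                (deg-u : deg G u ≡ 2) (deg-v : deg G v ≡ 3) where

  u≢v : u ≢ v
  u≢v = Adj⇒≢ G uv

  u≢w : u ≢ w
  u≢w = Adj⇒≢ G uw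

  v≢w : v ≢ w
  v≢w = Adj⇒≢ G vw

  v≢u : v ≢ u
  v≢u = ≢-sym u≢v

  w≢u : w ≢ u
  w≢u = ≢-sym u≢w

  x≢u : x ≢ u
  x≢u = x∉ ∘ here

  x≢w : x ≢ w
  x≢w = x∉ ∘ there ∘ here

  N-u : ∀ q → Adj G u q → q ∈ v ∷ w ∷ []
  N-u = neighbours-⊆ G u ((v≢w ∷ []) ∷ [] ∷ []) (λ { _ 1st → uv ; _ 2nd → uw }) deg-u

  N-v : ∀ q → Adj G v q → q ∈ u ∷ w ∷ x ∷ []
  N-v = neighbours-⊆ G v ((u≢w ∷ ≢-sym x≢u ∷ []) ∷ (≢-sym x≢w ∷ []) ∷ [] ∷ [])
          (λ { _ 1st → Adj-sym G uv ; _ 2nd → vw ; _ 3rd → vx }) deg-v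

module ReducibleΔ≥5 {Δ : ℕ} (Δ≥5 : 5 ≤ Δ) (G : Graph) {u v w x : Fin (n G)}
                    (uv : Adj G u v) (vw : Adj G v w) (uw : Adj G u w) (vx : Adj G v x) (x∉ : x ∉ u ∷ w ∷ [])
                    (deg-u : deg G u ≡ 2) (deg-v : deg G v ≡ 3) where
  open Triangle G uv vw uw vx x∉ deg-u deg-v
  open Severed G u (v ∷ [])

  deg-v<Δ∸1 : deg G v < Δ ∸ 1
  deg-v<Δ∸1 = subst (_< Δ ∸ 1) (sym deg-v) (∸-monoˡ-≤ 1 Δ≥5)

  deg-u<Δ∸1 : deg G u < Δ ∸ 1
  deg-u<Δ∸1 = subst (_< Δ ∸ 1) (sym deg-u) (≤-trans (n≤1+n 3) (∸-monoˡ-≤ 1 Δ≥5))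

  module _ {φ : Fin (n G) → Fin (n G) → Fin Δ} (φ-col : IsCondIncColoring H Δ φ)
           {β : Fin Δ} (β∉ : β ∉ φ w u ∷ φ v w ∷ φ v x ∷ [])
           {α : Fin Δ} (α∉ : α ∉ β ∷ φ u w ∷ φ w v ∷ φ x v ∷ []) where

    A B : Fin (n G) → Fin Δ
    A = updateAt (φ u) v (const α)
    B = updateAt (λ b → φ b u) v (const β)

    open Extension φ A B

    A-v : A v ≡ α
    A-v = updateAt-updates v (φ u)

    B-v : B v ≡ β
    B-v = updateAt-updates v (λ b → φ b u)

    A-kept : ∀ b → b ∉ v ∷ [] → A b ≡ φ u b
    A-kept b b∉ = updateAt-minimal b v (φ u) (b∉ ∘ here)

    B-kept : ∀ b → b ∉ v ∷ [] → B b ≡ φ b u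
    B-kept b b∉ = updateAt-minimal b v (λ b → φ b u) (b∉ ∘ here)

    A-w : A w ≡ φ u w
    A-w = A-kept w (∉-singleton (≢-sym v≢w))

    B-w : B w ≡ φ w u
    B-w = B-kept w (∉-singleton (≢-sym v≢w))

    A≢B : ∀ b → b ∈ v ∷ [] → A b ≢ B b
    A≢B _ 1st e = α∉ (here (trans (sym A-v) (trans e B-v)))

    A-distinct : ∀ b c → b ∈ v ∷ [] → Adj G u c → b ≢ c → A b ≢ A c
    A-distinct _ c 1st uc v≢c with N-u c uc
    ... | 1st = ⊥-elim (v≢c refl)
    ... | 2nd = λ e → α∉ (there (here (trans (sym A-v) (trans e A-w))))

    B-distinct : ∀ b c → b ∈ v ∷ [] → Adj G u c → b ≢ c → B b ≢ B c
    B-distinct _ c 1st uc v≢c with N-u c uc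
    ... | 1st = ⊥-elim (v≢c refl)
    ... | 2nd = λ e → β∉ (here (trans (sym B-v) (trans e B-w)))

    A-fresh : ∀ a c → a ∈ v ∷ [] → Adj G a c → c ≢ u → φ c a ≢ A a
    A-fresh _ c 1st vc c≢u with N-v c vc
    ... | 1st = ⊥-elim (c≢u refl)
    ... | 2nd = λ e → α∉ (there (there (here (sym (trans e A-v)))))
    ... | 3rd = λ e → α∉ (there (there (there (here (sym (trans e A-v))))))

    B-fresh : ∀ a c → a ∈ v ∷ [] → Adj G a c → c ≢ u → φ a c ≢ B a
    B-fresh _ c 1st vc c≢u with N-v c vc
    ... | 1st = ⊥-elim (c≢u refl)
    ... | 2nd = λ e → β∉ (there (here (sym (trans e B-v))))
    ... | 3rd = λ e → β∉ (there (there (here (sym (trans e B-v)))))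

    recoloured : IsCondIncColoring G Δ ψ
    recoloured = extension φ-col A-kept B-kept A≢B A-distinct B-distinct A-fresh B-fresh
                   (λ big → ⊥-elim (<⇒≱ deg-u<Δ∸1 big))
                   (λ { _ 1st big → ⊥-elim (<⇒≱ deg-v<Δ∸1 big) })

  reducible : Critical Δ G → ⊥
  reducible crit
    with φ , φ-col ← Critical.minimal crit H inclusion (inclusion-proper 1st uv)
    with β , β∉ ← ∉-exists (φ w u ∷ φ v w ∷ φ v x ∷ []) (≤-trans (n≤1+n 4) Δ≥5)
    with α , α∉ ← ∉-exists (β ∷ φ u w ∷ φ w v ∷ φ x v ∷ []) Δ≥5
    = Critical.noColoring crit (_ , recoloured φ-col β∉ α∉)

module ReducibleΔ≡4 (G : Graph) {u v w x y z : Fin (n G)}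
                    (uv : Adj G u v) (vw : Adj G v w) (uw : Adj G u w) (vx : Adj G v x) (x∉ : x ∉ u ∷ w ∷ [])
                    (wy : Adj G w y) (y∉ : y ∉ u ∷ v ∷ []) (wz : Adj G w z) (z∉ : z ∉ u ∷ v ∷ y ∷ [])
                    (deg-u : deg G u ≡ 2) (deg-v : deg G v ≡ 3) (deg-w : deg G w ≡ 4) where
  open Triangle G uv vw uw vx x∉ deg-u deg-v
  open Severed G u (v ∷ w ∷ [])

  y≢u : y ≢ u
  y≢u = y∉ ∘ here

  y≢v : y ≢ v
  y≢v = y∉ ∘ there ∘ here

  z≢u : z ≢ u
  z≢u = z∉ ∘ here

  z≢v : z ≢ v
  z≢v = z∉ ∘ there ∘ here

  z≢y : z ≢ y
  z≢y = z∉ ∘ there ∘ there ∘ here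

  N-w : ∀ q → Adj G w q → q ∈ u ∷ v ∷ y ∷ z ∷ []
  N-w = neighbours-⊆ G w
          ((u≢v ∷ ≢-sym y≢u ∷ ≢-sym z≢u ∷ []) ∷ (≢-sym y≢v ∷ ≢-sym z≢v ∷ []) ∷ (≢-sym z≢y ∷ []) ∷ [] ∷ [])
          (λ { _ 1st → Adj-sym G uw ; _ 2nd → Adj-sym G vw ; _ 3rd → wy ; _ 4th → wz }) deg-w

  H-vw : Adj H v w
  H-vw = Adj-away v≢u w≢u vw

  H-wv : Adj H w v
  H-wv = Adj-sym H H-vw

  H-vx : Adj H v x
  H-vx = Adj-away v≢u x≢u vx

  H-wy : Adj H w y
  H-wy = Adj-away w≢u y≢u wy

  H-wz : Adj H w z
  H-wz = Adj-away w≢u z≢u wz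

  3≤deg-H-w : 3 ≤ deg H w
  3≤deg-H-w = length-≤-deg H w ((≢-sym y≢v ∷ ≢-sym z≢v ∷ []) ∷ (≢-sym z≢y ∷ []) ∷ [] ∷ [])
                (λ { _ 1st → H-wv ; _ 2nd → H-wy ; _ 3rd → H-wz })

  module _ {φ : Fin (n G) → Fin (n G) → Fin 4} (φ-col : IsCondIncColoring H 4 φ) where
    open IsCondIncColoring φ-col

    s₁≢s₂ : φ v w ≢ φ v x
    s₁≢s₂ e = x≢w (sym (condC v w x H-vw H-vx e))

    t₁≢t₂ : φ w v ≢ φ x v
    t₁≢t₂ e = x≢w (sym (condB v w x H-vw H-vx e))

    s₁≢t₁ : φ v w ≢ φ w v
    s₁≢t₁ = condA v w H-vw

    s₂≢t₂ : φ v x ≢ φ x v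
    s₂≢t₂ = condA v x H-vx

    s₁≢y₁ : φ v w ≢ φ y w
    s₁≢y₁ e = y≢v (sym (condB w v y H-wv H-wy e))

    s₁≢z₁ : φ v w ≢ φ z w
    s₁≢z₁ e = z≢v (sym (condB w v z H-wv H-wz e))

    y₁≢z₁ : φ y w ≢ φ z w
    y₁≢z₁ e = z≢y (sym (condB w y z H-wy H-wz e))

    -- w has degree 3 = Δ - 1 in H, so γ appears at w in H.
    γ≢δ : ∀ {γ δ} → γ ∉ φ v w ∷ φ y w ∷ φ z w ∷ [] → δ ∉ φ w v ∷ φ w y ∷ φ w z ∷ [] → γ ≢ δ
    γ≢δ {γ} γ∉ δ∉ refl with r , wr , seen ← condD w 3≤deg-H-w γ with N-w r (Adj-H⇒G wr) | seen
    ... | 1st | _ = ¬Adj-severed 2nd (Adj-sym H wr)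
    ... | 2nd | inj₁ e = δ∉ (here (sym e))
    ... | 2nd | inj₂ e = γ∉ (here (sym e))
    ... | 3rd | inj₁ e = δ∉ (there (here (sym e)))
    ... | 3rd | inj₂ e = γ∉ (there (here (sym e)))
    ... | 4th | inj₁ e = δ∉ (there (there (here (sym e))))
    ... | 4th | inj₂ e = γ∉ (there (there (here (sym e))))

    module _ {γ : Fin 4} (γ∉ : γ ∉ φ v w ∷ φ y w ∷ φ z w ∷ [])
             {δ : Fin 4} (δ∉ : δ ∉ φ w v ∷ φ w y ∷ φ w z ∷ [])
             (choice : PairChoice (φ v w) (φ v x) (φ w v) (φ x v) γ δ) where
      open PairChoice choice

      A B : Fin (n G) → Fin 4
      A = updateAt (updateAt (φ u) w (const γ)) v (const α)
      B = updateAt (updateAt (λ b → φ b u) w (const δ)) v (const β)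

      open Extension φ A B

      A-v : A v ≡ α
      A-v = updateAt-updates v _

      B-v : B v ≡ β
      B-v = updateAt-updates v _

      A-w : A w ≡ γ
      A-w = trans (updateAt-minimal w v _ (≢-sym v≢w)) (updateAt-updates w (φ u))

      B-w : B w ≡ δ
      B-w = trans (updateAt-minimal w v _ (≢-sym v≢w)) (updateAt-updates w (λ b → φ b u))

      A-kept : ∀ b → b ∉ v ∷ w ∷ [] → A b ≡ φ u b
      A-kept b b∉ = trans (updateAt-minimal b v _ (b∉ ∘ here))
                          (updateAt-minimal b w (φ u) (b∉ ∘ there ∘ here))

      B-kept : ∀ b → b ∉ v ∷ w ∷ [] → B b ≡ φ b u
      B-kept b b∉ = trans (updateAt-minimal b v _ (b∉ ∘ here))
                          (updateAt-minimal b w _ (b∉ ∘ there ∘ here))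

      A≢B : ∀ b → b ∈ v ∷ w ∷ [] → A b ≢ B b
      A≢B _ 1st e = α≢β (trans (sym A-v) (trans e B-v))
      A≢B _ 2nd e = γ≢δ γ∉ δ∉ (trans (sym A-w) (trans e B-w))

      A-distinct : ∀ b c → b ∈ v ∷ w ∷ [] → Adj G u c → b ≢ c → A b ≢ A c
      A-distinct _ c b∈ uc b≢c with b∈ | N-u c uc
      ... | 1st | 1st = ⊥-elim (b≢c refl)
      ... | 1st | 2nd = λ e → α≢γ (trans (sym A-v) (trans e A-w))
      ... | 2nd | 1st = λ e → α≢γ (trans (sym A-v) (trans (sym e) A-w))
      ... | 2nd | 2nd = ⊥-elim (b≢c refl)

      B-distinct : ∀ b c → b ∈ v ∷ w ∷ [] → Adj G u c → b ≢ c → B b ≢ B c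
      B-distinct _ c b∈ uc b≢c with b∈ | N-u c uc
      ... | 1st | 1st = ⊥-elim (b≢c refl)
      ... | 1st | 2nd = λ e → β≢δ (trans (sym B-v) (trans e B-w))
      ... | 2nd | 1st = λ e → β≢δ (trans (sym B-v) (trans (sym e) B-w))
      ... | 2nd | 2nd = ⊥-elim (b≢c refl)

      A-fresh : ∀ a c → a ∈ v ∷ w ∷ [] → Adj G a c → c ≢ u → φ c a ≢ A a
      A-fresh _ c 1st vc c≢u with N-v c vc
      ... | 1st = ⊥-elim (c≢u refl)
      ... | 2nd = λ e → α∉t (here (sym (trans e A-v)))
      ... | 3rd = λ e → α∉t (there (here (sym (trans e A-v))))
      A-fresh _ c 2nd wc c≢u with N-w c wc
      ... | 1st = ⊥-elim (c≢u refl)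
      ... | 2nd = λ e → γ∉ (here (sym (trans e A-w)))
      ... | 3rd = λ e → γ∉ (there (here (sym (trans e A-w))))
      ... | 4th = λ e → γ∉ (there (there (here (sym (trans e A-w)))))

      B-fresh : ∀ a c → a ∈ v ∷ w ∷ [] → Adj G a c → c ≢ u → φ a c ≢ B a
      B-fresh _ c 1st vc c≢u with N-v c vc
      ... | 1st = ⊥-elim (c≢u refl)
      ... | 2nd = λ e → β∉s (here (sym (trans e B-v)))
      ... | 3rd = λ e → β∉s (there (here (sym (trans e B-v))))
      B-fresh _ c 2nd wc c≢u with N-w c wc
      ... | 1st = ⊥-elim (c≢u refl)
      ... | 2nd = λ e → δ∉ (here (sym (trans e B-w)))
      ... | 3rd = λ e → δ∉ (there (here (sym (trans e B-w))))
      ... | 4th = λ e → δ∉ (there (there (here (sym (trans e B-w)))))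

      covers-v : ∀ c → Appears G ψ v c
      covers-v c with covers c
      ... | 1st = w , vw , inj₁ (ψ-away v≢u w≢u)
      ... | 2nd = x , vx , inj₁ (ψ-away v≢u x≢u)
      ... | 3rd = w , vw , inj₂ (ψ-away w≢u v≢u)
      ... | 4th = x , vx , inj₂ (ψ-away x≢u v≢u)
      ... | 5th = u , Adj-sym G uv , inj₂ (trans (ψ-from-u v) A-v)
      ... | 6th = u , Adj-sym G uv , inj₁ (trans (ψ-to-u v≢u) B-v)

      covers-w : ∀ c → Appears G ψ w c
      covers-w c with four-covers s₁≢y₁ s₁≢z₁ (γ∉ ∘ here ∘ sym) y₁≢z₁
                                  (γ∉ ∘ there ∘ here ∘ sym) (γ∉ ∘ there ∘ there ∘ here ∘ sym) c
      ... | 1st = v , Adj-sym G vw , inj₂ (ψ-away v≢u w≢u)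
      ... | 2nd = y , wy , inj₂ (ψ-away y≢u w≢u)
      ... | 3rd = z , wz , inj₂ (ψ-away z≢u w≢u)
      ... | 4th = u , Adj-sym G uw , inj₂ (trans (ψ-from-u w) A-w)

      recoloured : IsCondIncColoring G 4 ψ
      recoloured = extension φ-col A-kept B-kept A≢B A-distinct B-distinct A-fresh B-fresh
                     (λ big → ⊥-elim (<⇒≱ (subst (_< 3) (sym deg-u) ≤-refl) big))
                     (λ { _ 1st _ → covers-v ; _ 2nd _ → covers-w })

  reducible : Critical 4 G → ⊥
  reducible crit
    with φ , φ-col ← Critical.minimal crit H inclusion (inclusion-proper 1st uv)
    with γ , γ∉ ← ∉-exists (φ v w ∷ φ y w ∷ φ z w ∷ []) ≤-refl
    with δ , δ∉ ← ∉-exists (φ w v ∷ φ w y ∷ φ w z ∷ []) ≤-refl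
    = Critical.noColoring crit (_ , recoloured φ-col γ∉ δ∉
        (pair-choice (s₁≢s₂ φ-col) (t₁≢t₂ φ-col) (s₁≢t₁ φ-col) (s₂≢t₂ φ-col)
                     (γ∉ ∘ here) (δ∉ ∘ here) (γ≢δ φ-col γ∉ δ∉)))

lemma14 : (Δ : ℕ) → 4 ≤ Δ → (G : Graph) → Critical Δ G →
          ¬ (∃[ u ] ∃[ v ] ∃[ w ]
               (Adj G u v × Adj G v w × Adj G u w ×
                deg G u ≡ 2 × deg G v ≡ 3 × deg G w ≡ 4))
lemma14 Δ 4≤Δ G crit (u , v , w , uv , vw , uw , deg-u , deg-v , deg-w)
  with x , vx , x∉ ← ∃-neighbour-∉ G v (u ∷ w ∷ []) (subst (2 <_) (sym deg-v) ≤-refl)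
  with m≤n⇒m<n∨m≡n 4≤Δ
... | inj₁ Δ≥5 = ReducibleΔ≥5.reducible Δ≥5 G uv vw uw vx x∉ deg-u deg-v crit
... | inj₂ refl
  with y , wy , y∉ ← ∃-neighbour-∉ G w (u ∷ v ∷ []) (subst (2 <_) (sym deg-w) (n≤1+n 3))
  with z , wz , z∉ ← ∃-neighbour-∉ G w (u ∷ v ∷ y ∷ []) (subst (3 <_) (sym deg-w) ≤-refl)
  = ReducibleΔ≡4.reducible G uv vw uw vx x∉ wy y∉ wz z∉ deg-u deg-v deg-w crit
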